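{- Let $\mathcal{C}$ be a connected Stembridge crystal of type $A_{n-1}$ (weights normalized as in the context) and $\mathcal{Q}_{\mathcal{C}}$ its associated quasi-crystal structure. Let $i,j\in I$ with $|i-j|>1$, and let $x,y\in\mathcal{C}$ with $\ddot e_i(x)=y$. Then $\ddot\varepsilon_j(x)=+\infty$ if and only if $\ddot\varepsilon_j(y)=+\infty$.
   Context: Fix $n\ge2$, $I=\{1,\dots,n-1\}$, $\alpha_i=\mathbf{e}_i-\mathbf{e}_{i+1}\in\mathbb{Z}^n$, standard inner product. A crystal of type $A_{n-1}$ is a non-empty set $\mathcal{C}$ with maps $\widetilde e_i,\widetilde f_i:\mathcal{C}\to\mathcal{C}\sqcup\{\bot\}$, $\widetilde\varepsilon_i,\widetilde\varphi_i:\mathcal{C}\to\mathbb{Z}\sqcup\{ -\infty\}$, $\mathrm{wt}:\mathcal{C}\to\mathbb{Z}^n$ such that (C1) $\widetilde e_i(x)=y\iff x=\widetilde f_i(y)$, and then $\mathrm{wt}(y)=\mathrm{wt}(x)+\alpha_i$, $\widetilde\varepsilon_i(y)=\widetilde\varepsilon_i(x)-1$, $\widetilde\varphi_i(y)=\widetilde\varphi_i(x)+1$; (C2) $\widetilde\varphi_i(x)=\widetilde\varepsilon_i(x)+\langle\mathrm{wt}(x),\alpha_i\rangle$; (C3) if $\widetilde\varepsilon_i(x)=-\infty$ then $\widetilde e_i(x)=\widetilde f_i(x)=\bot$. Seminormal: $\widetilde\varepsilon_i(x)=\max\{k:\widetilde e_i^k(x)\ne\bot\}$, $\widetilde\varphi_i(x)=\max\{k:\widetilde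 f_i^k(x)\ne\bot\}$. A Stembridge crystal is a seminormal crystal satisfying Stembridge's axioms S1, S2, S2$'$, S3, S3$'$ for simply-laced type (in S1: if $\widetilde e_i(x)=y$ and $j\neq i$ then $\widetilde\varepsilon_j(y)\in\{\widetilde\varepsilon_j(x),\widetilde\varepsilon_j(x)+1\}$, the latter only if $|i-j|=1$). Weight convention: weights in $\mathbb{Z}^n$ normalized so that the highest weight is a partition; in particular all $\mathrm{wt}(x)$ have non-negative entries; $\mathrm{wt}_k(x)$ is the $k$-th entry. The associated structure $\mathcal{Q}_{\mathcal{C}}$ has the same set and weights, with $\ddot\varepsilon_i(x)=\widetilde\varepsilon_i(x)$ if $\widetilde\varepsilon_i(x)=\mathrm{wt}_{i+1}(x)$ and $+\infty$ otherwise; $\ddot e_i(x)=\widetilde e_i(x)$ if $\widetilde\varepsilon_i(x)=\mathrm{wt}_{i+1}(x)$ and $\bot$ otherwise; $\ddot\varphi_i(x)=\ddot\varepsilon_i(x)+\langle\mathrm{wt}(x),\alpha_i\rangle$; $\ddot f_i(x)=y$ iff $\ddot e_i(y)=x$. -}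

module Defs where

open import Data.Nat using (ℕ; zero; suc; ∣_-_∣) renaming (_≤_ to _≤ℕ_)
open import Data.Integer using (ℤ; +_; -[1+_]; _+_; _-_; _≤_; 0ℤ; 1ℤ; -1ℤ)
import Data.Integer as ℤ
open import Data.Fin using (Fin; zero; suc; inject₁; toℕ)
import Data.Fin as Fin
open import Data.Maybe using (Maybe; just; nothing; _>>=_)
import Data.Maybe as Maybe
open import Data.Product using (Σ; ∃; _×_; _,_)
open import Data.Sum using (_⊎_)
open import Relation.Binary.PropositionalEquality using (_≡_; _≢_)
open import Relation.Nullary using (yes; no)

-- Type A_{n-1} with n = suc m.  The index set I = {1,…,n-1} is Fin m:
-- the element i : Fin m stands for the paper's index (toℕ i + 1).
-- Weights live in ℤ^n, represented as functions Fin (suc m) → ℤ; the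
-- coordinate k : Fin (suc m) stands for the paper's coordinate (toℕ k + 1).
-- Thus the paper's coordinates i and i+1 are  inject₁ i  and  suc i.
-- The value -∞ of ε̃, φ̃ is encoded as  nothing  in  Maybe ℤ,
-- and ⊥ (the result of an undefined operator) as  nothing  in  Maybe C.

data ℤ±∞ : Set where
  -∞  : ℤ±∞
  fin : ℤ → ℤ±∞
  +∞  : ℤ±∞

Weight : ℕ → Set
Weight m = Fin (suc m) → ℤ

basis : ∀ {m} → Fin (suc m) → Weight m
basis k l with k Fin.≟ l
... | yes _ = 1ℤ
... | no  _ = 0ℤ

α : ∀ {m} → Fin m → Weight m
α i k = basis (inject₁ i) k - basis (suc i) k

_+ʷ_ : ∀ {m} → Weight m → Weight m → Weight m
(v +ʷ w) k = v k + w k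

ip : ∀ N → (Fin N → ℤ) → (Fin N → ℤ) → ℤ
ip zero    v w = 0ℤ
ip (suc N) v w = v zero ℤ.* w zero + ip N (λ k → v (suc k)) (λ k → w (suc k))

⟨_,_⟩ : ∀ {m} → Weight m → Weight m → ℤ
⟨_,_⟩ {m} v w = ip (suc m) v w

_⊕_ : Maybe ℤ → ℤ → Maybe ℤ
a ⊕ z = Maybe.map (λ t → t + z) a

iter : ∀ {C : Set} → (C → Maybe C) → ℕ → C → Maybe C
iter g zero    x = just x
iter g (suc k) x = iter g k x >>= g

record Crystal (m : ℕ) : Set₁ where
  field
    Carrier : Set
    e f     : Fin m → Carrier → Maybe Carrier
    ε φ     : Fin m → Carrier → Maybe ℤ
    wt      : Carrier → Weight m
    C1-ef   : ∀ i x y → e i x ≡ just y → f i y ≡ just x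
    C1-fe   : ∀ i x y → f i y ≡ just x → e i x ≡ just y
    C1-wt   : ∀ i x y → e i x ≡ just y → ∀ k → wt y k ≡ (wt x +ʷ α i) k
    C1-ε    : ∀ i x y → e i x ≡ just y → ε i y ≡ ε i x ⊕ -1ℤ
    C1-φ    : ∀ i x y → e i x ≡ just y → φ i y ≡ φ i x ⊕ 1ℤ
    C2      : ∀ i x → φ i x ≡ ε i x ⊕ ⟨ wt x , α i ⟩
    C3      : ∀ i x → ε i x ≡ nothing → e i x ≡ nothing × f i x ≡ nothing

module _ {m : ℕ} (𝒞 : Crystal m) where
  open Crystal 𝒞

  Seminormal : Set
  Seminormal =
    (∀ i x → ∃ λ (k : ℕ) → ε i x ≡ just (+ k)
                         × iter (e i) k x ≢ nothing
                         × iter (e i) (suc k) x ≡ nothing)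
    × (∀ i x → ∃ λ (k : ℕ) → φ i x ≡ just (+ k)
                           × iter (f i) k x ≢ nothing
                           × iter (f i) (suc k) x ≡ nothing)

  S1 : Set
  S1 = ∀ i j x y → i ≢ j → e i x ≡ just y →
         ε j y ≡ ε j x ⊎ (ε j y ≡ ε j x ⊕ 1ℤ × ∣ toℕ i - toℕ j ∣ ≡ 1)

  S2 : Set
  S2 = ∀ i j x xi xj → i ≢ j → e i x ≡ just xi → e j x ≡ just xj →
         ε j xi ≡ ε j x →
         ∃ λ y → e i xj ≡ just y × e j xi ≡ just y × φ i xi ≡ φ i y

  S2′ : Set
  S2′ = ∀ i j x xi xj → i ≢ j → f i x ≡ just xi → f j x ≡ just xj →
          φ j xi ≡ φ j x →
          ∃ λ y → f i xj ≡ just y × f j xi ≡ just y × ε i xi ≡ ε i y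

  S3 : Set
  S3 = ∀ i j x xi xj → i ≢ j → e i x ≡ just xi → e j x ≡ just xj →
         ε j xi ≡ ε j x ⊕ 1ℤ → ε i xj ≡ ε i x ⊕ 1ℤ →
         ∃ λ y → (just xi >>= e j >>= e j >>= e i) ≡ just y
               × (just xj >>= e i >>= e i >>= e j) ≡ just y
               × (f i y >>= φ j) ≡ φ j y ⊕ 1ℤ
               × (f j y >>= φ i) ≡ φ i y ⊕ 1ℤ

  S3′ : Set
  S3′ = ∀ i j x xi xj → i ≢ j → f i x ≡ just xi → f j x ≡ just xj →
          φ j xi ≡ φ j x ⊕ 1ℤ → φ i xj ≡ φ i x ⊕ 1ℤ →
          ∃ λ y → (just xi >>= f j >>= f j >>= f i) ≡ just y
                × (just xj >>= f i >>= f i >>= f j) ≡ just y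
                × (e i y >>= ε j) ≡ ε j y ⊕ 1ℤ
                × (e j y >>= ε i) ≡ ε i y ⊕ 1ℤ

  IsStembridge : Set
  IsStembridge = Seminormal × S1 × S2 × S2′ × S3 × S3′

  data Path : Carrier → Carrier → Set where
    here  : ∀ {x} → Path x x
    via-e : ∀ {x y z} i → e i x ≡ just y → Path y z → Path x z
    via-f : ∀ {x y z} i → f i x ≡ just y → Path y z → Path x z

  Connected : Set
  Connected = ∀ x y → Path x y

  IsPartition : Weight m → Set
  IsPartition w = (∀ k → 0ℤ ≤ w k) × (∀ (i : Fin m) → w (suc i) ≤ w (inject₁ i))

  Normalized : Set
  Normalized =
    (Σ Carrier λ u → (∀ i → e i u ≡ nothing) × IsPartition (wt u))
    × (∀ x k → 0ℤ ≤ wt x k)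

  ε̈ : Fin m → Carrier → ℤ±∞
  ε̈ i x with ε i x
  ... | nothing = +∞
  ... | just z with z ℤ.≟ wt x (suc i)
  ...   | yes _ = fin z
  ...   | no  _ = +∞

  ë : Fin m → Carrier → Maybe Carrier
  ë i x with ε i x
  ... | nothing = nothing
  ... | just z with z ℤ.≟ wt x (suc i)
  ...   | yes _ = e i x
  ...   | no  _ = nothing

{-# OPTIONS --safe #-}
-- The j-string through x is untouched by ẽ_i when i and j are not adjacent:
-- axiom S1 gives ε̃_j(ẽ_i x) = ε̃_j(x), and α_i vanishes in coordinate j+1, so
-- wt_{j+1} is unchanged as well.  Since ε̈_j is a function of the pair
-- (ε̃_j, wt_{j+1}) alone, ε̈_j(y) = ε̈_j(x) outright.
module Submission where

open import Defs
open import Data.Nat using (ℕ; _≤_; _<_; ∣_-_∣) renaming (suc to 1+)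
import Data.Nat.Properties as ℕ
open import Data.Fin using (Fin; toℕ; inject₁; suc)
import Data.Fin as Fin
import Data.Fin.Properties as Fin
open import Data.Integer using (ℤ; 0ℤ)
import Data.Integer as ℤ
import Data.Integer.Properties as ℤ
open import Data.Maybe using (Maybe; just; nothing)
open import Data.Product using (_×_; _,_)
open import Data.Sum using (inj₁; inj₂)
open import Data.Empty using (⊥-elim)
open import Relation.Binary.PropositionalEquality
open import Relation.Nullary using (yes; no)
open import Function using (_∘′_; case_of_)
open Crystal

∣1+n-n∣≡1 : ∀ n → ∣ 1+ n - n ∣ ≡ 1
∣1+n-n∣≡1 n = trans (ℕ.m≤n⇒∣n-m∣≡n∸m (ℕ.n≤1+n n)) (ℕ.m+n∸n≡m 1 n)

module _ {m : ℕ} {i j : Fin m} (distant : 1 < ∣ toℕ i - toℕ j ∣) where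

  distant⇒≢ : i ≢ j
  distant⇒≢ refl = ℕ.n≮0 (subst (1 <_) (ℕ.∣n-n∣≡0 (toℕ i)) distant)

  distant⇒∣i-j∣≢1 : ∣ toℕ i - toℕ j ∣ ≢ 1
  distant⇒∣i-j∣≢1 d = ℕ.<-irrefl refl (subst (1 <_) d distant)

  distant⇒inject₁≢suc : inject₁ i ≢ suc j
  distant⇒inject₁≢suc i≡1+j = distant⇒∣i-j∣≢1 (begin
    ∣ toℕ i - toℕ j ∣             ≡⟨ cong (∣_- toℕ j ∣) toℕi≡1+toℕj ⟩
    ∣ 1+ (toℕ j) - toℕ j ∣        ≡⟨ ∣1+n-n∣≡1 (toℕ j) ⟩
    1                             ∎)
    where
    open ≡-Reasoning
    toℕi≡1+toℕj : toℕ i ≡ 1+ (toℕ j)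
    toℕi≡1+toℕj = trans (sym (Fin.toℕ-inject₁ i)) (cong toℕ i≡1+j)

  distant⇒suc≢suc : suc i ≢ suc j
  distant⇒suc≢suc = distant⇒≢ ∘′ Fin.suc-injective

basis-≢ : ∀ {m} {k l : Fin (1+ m)} → k ≢ l → basis k l ≡ 0ℤ
basis-≢ {k = k} {l} k≢l with k Fin.≟ l
... | yes k≡l = ⊥-elim (k≢l k≡l)
... | no  _   = refl

α-outside-support : ∀ {m} (i : Fin m) {k : Fin (1+ m)} →
  inject₁ i ≢ k → suc i ≢ k → α i k ≡ 0ℤ
α-outside-support i i≢k 1+i≢k
  rewrite basis-≢ i≢k | basis-≢ 1+i≢k = refl

ε̈-from : Maybe ℤ → ℤ → ℤ±∞
ε̈-from nothing  w = +∞
ε̈-from (just z) w with z ℤ.≟ w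
... | yes _ = fin z
... | no  _ = +∞

module _ {m : ℕ} (𝒞 : Crystal m) where

  ε̈≡ε̈-from : ∀ j u → ε̈ 𝒞 j u ≡ ε̈-from (ε 𝒞 j u) (wt 𝒞 u (suc j))
  ε̈≡ε̈-from j u with ε 𝒞 j u
  ... | nothing = refl
  ... | just z with z ℤ.≟ wt 𝒞 u (suc j)
  ...   | yes _ = refl
  ...   | no  _ = refl

  ε̈-cong : ∀ j {u v} → ε 𝒞 j u ≡ ε 𝒞 j v → wt 𝒞 u (suc j) ≡ wt 𝒞 v (suc j) →
    ε̈ 𝒞 j u ≡ ε̈ 𝒞 j v
  ε̈-cong j {u} {v} εu≡εv wtu≡wtv = begin
    ε̈ 𝒞 j u                                ≡⟨ ε̈≡ε̈-from j u ⟩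
    ε̈-from (ε 𝒞 j u) (wt 𝒞 u (suc j))      ≡⟨ cong₂ ε̈-from εu≡εv wtu≡wtv ⟩
    ε̈-from (ε 𝒞 j v) (wt 𝒞 v (suc j))      ≡⟨ ε̈≡ε̈-from j v ⟨
    ε̈ 𝒞 j v                                ∎
    where open ≡-Reasoning

  ë⇒e : ∀ i {x y} → ë 𝒞 i x ≡ just y → e 𝒞 i x ≡ just y
  ë⇒e i {x} ëx≡y with ε 𝒞 i x
  ... | nothing = case ëx≡y of λ ()
  ... | just z with z ℤ.≟ wt 𝒞 x (suc i)
  ...   | yes _ = ëx≡y
  ...   | no  _ = case ëx≡y of λ ()

  e-preserves-wt-outside-support : ∀ i {x y} {k : Fin (1+ m)} →
    e 𝒞 i x ≡ just y → inject₁ i ≢ k → suc i ≢ k → wt 𝒞 y k ≡ wt 𝒞 x k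
  e-preserves-wt-outside-support i {x} {y} {k} ex≡y i≢k 1+i≢k = begin
    wt 𝒞 y k                  ≡⟨ C1-wt 𝒞 i x y ex≡y k ⟩
    wt 𝒞 x k ℤ.+ α i k        ≡⟨ cong (λ t → wt 𝒞 x k ℤ.+ t) (α-outside-support i i≢k 1+i≢k) ⟩
    wt 𝒞 x k ℤ.+ 0ℤ           ≡⟨ ℤ.+-identityʳ (wt 𝒞 x k) ⟩
    wt 𝒞 x k                  ∎
    where open ≡-Reasoning

  S1-distant : S1 𝒞 → ∀ {i j x y} → 1 < ∣ toℕ i - toℕ j ∣ →
    e 𝒞 i x ≡ just y → ε 𝒞 j y ≡ ε 𝒞 j x
  S1-distant s1 {i} {j} {x} {y} distant ex≡y
    with s1 i j x y (distant⇒≢ distant) ex≡y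
  ... | inj₁ εy≡εx    = εy≡εx
  ... | inj₂ (_ , ∣i-j∣≡1) = ⊥-elim (distant⇒∣i-j∣≢1 {i = i} {j} distant ∣i-j∣≡1)

  e-preserves-ε̈-distant : S1 𝒞 → ∀ {i j x y} → 1 < ∣ toℕ i - toℕ j ∣ →
    e 𝒞 i x ≡ just y → ε̈ 𝒞 j y ≡ ε̈ 𝒞 j x
  e-preserves-ε̈-distant s1 {i} {j} distant ex≡y = ε̈-cong j
    (S1-distant s1 distant ex≡y)
    (e-preserves-wt-outside-support i ex≡y
      (distant⇒inject₁≢suc distant) (distant⇒suc≢suc distant))

lemma4p7 : (m : ℕ) → 1 ≤ m → (𝒞 : Crystal m) →
    IsStembridge 𝒞 → Connected 𝒞 → Normalized 𝒞 →
    (i j : Fin m) → 1 < ∣ toℕ i - toℕ j ∣ →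
    (x y : Carrier 𝒞) → ë 𝒞 i x ≡ just y →
    (ε̈ 𝒞 j x ≡ +∞ → ε̈ 𝒞 j y ≡ +∞) × (ε̈ 𝒞 j y ≡ +∞ → ε̈ 𝒞 j x ≡ +∞)
lemma4p7 m _ 𝒞 (_ , s1 , _) _ _ i j distant x y ëx≡y =
  trans ε̈y≡ε̈x , trans (sym ε̈y≡ε̈x)
  where
  ε̈y≡ε̈x : ε̈ 𝒞 j y ≡ ε̈ 𝒞 j x
  ε̈y≡ε̈x = e-preserves-ε̈-distant 𝒞 s1 distant (ë⇒e 𝒞 i ëx≡y)
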